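{- For every integer $m\geq 1$ we have $a(2m+1)=a(2m)$, and every attainable partition of $2m+1$ is of the form $(n_1+1,n_2,\dots,n_r)$ for some partition $(n_1,n_2,\dots,n_r)$ of $2m$.
   Context: A partition of a positive integer $n$ is a tuple $\lambda=(n_1,n_2,\dots,n_r)$ of positive integers with $n_1\geq n_2\geq\dots\geq n_r$ and $n_1+\dots+n_r=n$. The cyclicity index of $\lambda$ is $c(\lambda)=\sum_{i=1}^r(3-2i)n_i$, and $\lambda$ is attainable if $c(\lambda)\geq 0$. $a(n)$ denotes the number of attainable partitions of $n$. -}

module Defs where

open import Data.Nat as ℕ using (ℕ; zero; suc; _≥_; _<_; _≥?_; _<?_)
open import Data.Integer as ℤ using (ℤ; +_; _-_; _*_; _+_; _≤_; _≤?_)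
open import Data.List using (List; []; _∷_; length; filter; map; concatMap; upTo; applyUpTo)
open import Data.Nat.ListAction using (sum)
open import Data.List.Relation.Unary.All using (All; all?)
open import Data.List.Relation.Unary.Linked using (Linked; linked?)
open import Data.Product using (_×_)
open import Relation.Binary.PropositionalEquality using (_≡_)
open import Relation.Nullary using (Dec)
open import Relation.Nullary.Decidable using (_×-dec_)

IsPartition : ℕ → List ℕ → Set
IsPartition n l = Linked _≥_ l × All (0 <_) l × sum l ≡ n

isPartition? : ∀ n l → Dec (IsPartition n l)
isPartition? n l = linked? _≥?_ l ×-dec all? (0 <?_) l ×-dec (sum l ℕ.≟ n)

cycAux : ℕ → List ℕ → ℤ
cycAux i []       = + 0
cycAux i (x ∷ xs) = (+ 3 - + 2 * + i) * + x + cycAux (suc i) xs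

cyclicity : List ℕ → ℤ
cyclicity l = cycAux 1 l

Attainable : List ℕ → Set
Attainable l = + 0 ≤ cyclicity l

attainable? : ∀ l → Dec (Attainable l)
attainable? l = + 0 ≤? cyclicity l

listsOf : ℕ → ℕ → List (List ℕ)
listsOf n zero    = [] ∷ []
listsOf n (suc k) = concatMap (λ x → map (x ∷_) (listsOf n k)) (applyUpTo suc n)

-- All lists of length ≤ n with entries in {1,…,n}; every partition of n occurs exactly once
candidates : ℕ → List (List ℕ)
candidates n = concatMap (listsOf n) (upTo (suc n))

a : ℕ → ℕ
a n = length (filter (λ l → isPartition? n l ×-dec attainable? l) (candidates n))

incHead : List ℕ → List ℕ
incHead []       = []
incHead (x ∷ xs) = suc x ∷ xs

-- Write λ = (n₁ ∷ t). Then c(λ) = n₁ − w(t) with w(t) = Σⱼ (2j+1) tⱼ, so λ is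
-- attainable iff w(t) ≤ n₁. Since w(t) ≥ Σ t ≥ n₂ and w(t) ≡ Σ t (mod 2), for |λ|
-- odd the equality w(t) = n₁ is excluded, whence n₁ > w(t) ≥ n₂: lowering n₁ by one
-- gives an attainable partition of |λ| − 1. Conversely raising the first part of an
-- attainable partition keeps it attainable, so incHead is a bijection between the
-- attainable partitions of 2m and those of 2m + 1.
module Submission where

open import Defs
open import Data.Nat as ℕ using (ℕ; zero; suc; _+_; _*_; _≤_; _<_; _≥_; z≤n; s≤s)
import Data.Nat.Properties as ℕ
open import Data.Integer as ℤ using (ℤ; +_; -_; +≤+)
import Data.Integer.Properties as ℤ
import Data.Integer.Tactic.RingSolver as ℤ-Solver
import Data.Nat.Tactic.RingSolver as ℕ-Solver
open import Data.List using (List; []; _∷_; length; map; concatMap; applyUpTo; filter)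
open import Data.List.Properties using (length-map; ∷-injectiveˡ; ∷-injectiveʳ)
open import Data.Nat.ListAction using (sum)
open import Data.List.Relation.Unary.All as All using (All; []; _∷_)
import Data.List.Relation.Unary.All.Properties as All
open import Data.List.Relation.Unary.Any using (here)
import Data.List.Relation.Unary.AllPairs as AllPairs
import Data.List.Relation.Unary.AllPairs.Properties as AllPairs
open import Data.List.Relation.Unary.Linked as Linked using (Linked; [-]; _∷_)
open import Data.List.Relation.Unary.Unique.Propositional using (Unique)
import Data.List.Relation.Unary.Unique.Propositional.Properties as Unique
open import Data.List.Relation.Binary.Disjoint.Propositional using (Disjoint)
open import Data.List.Membership.Propositional using (_∈_)
open import Data.List.Membership.Propositional.Properties
open import Data.List.Membership.Propositional.Properties.WithK using (unique∧set⇒bag)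
open import Data.List.Relation.Binary.BagAndSetEquality using (∼bag⇒↭)
open import Data.List.Relation.Binary.Permutation.Propositional.Properties using (↭-length)
open import Data.Product using (_×_; _,_; proj₁; proj₂; ∃-syntax)
open import Function.Bundles using (_⇔_; mk⇔; Equivalence)
open import Relation.Binary.PropositionalEquality
open import Relation.Nullary.Decidable using (_×-dec_)
open import Data.Empty using (⊥-elim)
open import Function using (_∘′_)

tailWeight : ℕ → List ℕ → ℕ
tailWeight i []       = 0
tailWeight i (y ∷ ys) = suc (2 * i) * y + tailWeight (suc i) ys

coefficient-from-2 : ∀ i → + 3 ℤ.- + 2 ℤ.* + (2 + i) ≡ - + suc (2 * i)
coefficient-from-2 i = begin
  + 3 ℤ.- + 2 ℤ.* + (2 + i)   ≡⟨ cong (λ z → + 3 ℤ.- + 2 ℤ.* z) (ℤ.pos-+ 2 i) ⟩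
  + 3 ℤ.- + 2 ℤ.* (+ 2 ℤ.+ + i) ≡⟨ expand (+ i) ⟩
  - (+ 1 ℤ.+ + 2 ℤ.* + i)       ≡⟨ cong (λ z → - (+ 1 ℤ.+ z)) (ℤ.pos-* 2 i) ⟨
  - (+ 1 ℤ.+ + (2 * i))         ≡⟨ cong -_ (ℤ.pos-+ 1 (2 * i)) ⟨
  - + suc (2 * i)               ∎
  where
  open ≡-Reasoning
  expand : ∀ z → + 3 ℤ.- + 2 ℤ.* (+ 2 ℤ.+ z) ≡ - (+ 1 ℤ.+ + 2 ℤ.* z)
  expand = ℤ-Solver.solve-∀

cycAux-from-2 : ∀ i xs → cycAux (2 + i) xs ≡ - + tailWeight i xs
cycAux-from-2 i []       = refl
cycAux-from-2 i (y ∷ ys) = begin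
  (+ 3 ℤ.- + 2 ℤ.* + (2 + i)) ℤ.* + y ℤ.+ cycAux (3 + i) ys
    ≡⟨ cong₂ (λ c r → c ℤ.* + y ℤ.+ r) (coefficient-from-2 i) (cycAux-from-2 (suc i) ys) ⟩
  - + suc (2 * i) ℤ.* + y ℤ.+ - + w
    ≡⟨ negate-out (+ suc (2 * i)) (+ y) (+ w) ⟩
  - (+ suc (2 * i) ℤ.* + y ℤ.+ + w)
    ≡⟨ cong (λ z → - (z ℤ.+ + w)) (ℤ.pos-* (suc (2 * i)) y) ⟨
  - (+ (suc (2 * i) * y) ℤ.+ + w)
    ≡⟨ cong -_ (ℤ.pos-+ (suc (2 * i) * y) w) ⟨
  - + tailWeight i (y ∷ ys)
    ∎
  where
  open ≡-Reasoning
  w = tailWeight (suc i) ys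
  negate-out : ∀ a b c → - a ℤ.* b ℤ.+ - c ≡ - (a ℤ.* b ℤ.+ c)
  negate-out = ℤ-Solver.solve-∀

cyclicity-∷ : ∀ x xs → cyclicity (x ∷ xs) ≡ + x ℤ.- + tailWeight 0 xs
cyclicity-∷ x xs = cong₂ ℤ._+_ (ℤ.*-identityˡ (+ x)) (cycAux-from-2 0 xs)

attainable-∷⇔ : ∀ x xs → Attainable (x ∷ xs) ⇔ tailWeight 0 xs ≤ x
attainable-∷⇔ x xs = mk⇔
  (λ att → ℤ.drop‿+≤+ (ℤ.0≤i-j⇒j≤i (subst (+ 0 ℤ.≤_) (cyclicity-∷ x xs) att)))
  (λ w≤x → subst (+ 0 ℤ.≤_) (sym (cyclicity-∷ x xs)) (ℤ.i≤j⇒0≤j-i (+≤+ w≤x)))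

sum≤tailWeight : ∀ i xs → sum xs ≤ tailWeight i xs
sum≤tailWeight i []       = z≤n
sum≤tailWeight i (y ∷ ys) = ℕ.+-mono-≤ (ℕ.m≤n*m y (suc (2 * i))) (sum≤tailWeight (suc i) ys)

tailWeight+sum-even : ∀ i xs → ∃[ k ] tailWeight i xs + sum xs ≡ 2 * k
tailWeight+sum-even i []       = 0 , refl
tailWeight+sum-even i (y ∷ ys) with tailWeight+sum-even (suc i) ys
... | k , w+s≡2k = suc i * y + k , (begin
  suc (2 * i) * y + tailWeight (suc i) ys + (y + sum ys)
    ≡⟨ regroup (suc (2 * i) * y) (tailWeight (suc i) ys) y (sum ys) ⟩
  (suc (2 * i) * y + y) + (tailWeight (suc i) ys + sum ys)
    ≡⟨ cong₂ _+_ (double i y) w+s≡2k ⟩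
  2 * (suc i * y) + 2 * k
    ≡⟨ ℕ.*-distribˡ-+ 2 (suc i * y) k ⟨
  2 * (suc i * y + k)
    ∎)
  where
  open ≡-Reasoning
  regroup : ∀ a b c d → a + b + (c + d) ≡ (a + c) + (b + d)
  regroup = ℕ-Solver.solve-∀
  double : ∀ i y → suc (2 * i) * y + y ≡ 2 * (suc i * y)
  double = ℕ-Solver.solve-∀

odd⇒tailWeight≢head : ∀ {m x xs} → x + sum xs ≡ suc (2 * m) → tailWeight 0 xs ≢ x
odd⇒tailWeight≢head {m} {x} {xs} odd w≡x with tailWeight+sum-even 0 xs
... | k , even = ℕ.even≢odd k m (trans (sym even) (trans (cong (ℕ._+ sum xs) w≡x) odd))

odd-attainable⇒tailWeight<head : ∀ {m x xs} → x + sum xs ≡ suc (2 * m) →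
                                  Attainable (x ∷ xs) → tailWeight 0 xs < x
odd-attainable⇒tailWeight<head {m} {x} {xs} odd att =
  ℕ.≤∧≢⇒< (Equivalence.to (attainable-∷⇔ x xs) att) (odd⇒tailWeight≢head {m} {x} {xs} odd)

sum≤⇒linked-∷ : ∀ {x xs} → sum xs ≤ x → Linked _≥_ xs → Linked _≥_ (x ∷ xs)
sum≤⇒linked-∷ {xs = []}     _   _      = [-]
sum≤⇒linked-∷ {xs = y ∷ ys} s≤x linked = ℕ.≤-trans (ℕ.m≤m+n y (sum ys)) s≤x ∷ linked

lowerHead-isPartition : ∀ {n x xs} → 0 < n → sum xs ≤ x →
                        IsPartition (suc n) (suc x ∷ xs) → IsPartition n (x ∷ xs)
lowerHead-isPartition {x = zero} 0<n s≤0 (_ , _ , sum≡) =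
  ⊥-elim (ℕ.n≮0 (ℕ.<-≤-trans 0<n (subst (_≤ 0) (ℕ.suc-injective sum≡) s≤0)))
lowerHead-isPartition {x = suc x} 0<n s≤x (linked , _ ∷ positive , sum≡) =
  sum≤⇒linked-∷ s≤x (Linked.tail linked) , s≤s z≤n ∷ positive , ℕ.suc-injective sum≡

incHead-isPartition : ∀ {n μ} → 0 < n → IsPartition n μ → IsPartition (suc n) (incHead μ)
incHead-isPartition {μ = []}     0<n (_ , _ , refl) = ⊥-elim (ℕ.n≮0 0<n)
incHead-isPartition {μ = x ∷ xs} _   (linked , _ ∷ positive , sum≡) =
  raise linked , s≤s z≤n ∷ positive , cong suc sum≡
  where
  raise : Linked _≥_ (x ∷ xs) → Linked _≥_ (suc x ∷ xs)
  raise [-]          = [-]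
  raise (y≤x ∷ rest) = ℕ.m≤n⇒m≤1+n y≤x ∷ rest

incHead-attainable : ∀ μ → Attainable μ → Attainable (incHead μ)
incHead-attainable []       att = att
incHead-attainable (x ∷ xs) att =
  Equivalence.from (attainable-∷⇔ (suc x) xs)
    (ℕ.m≤n⇒m≤1+n (Equivalence.to (attainable-∷⇔ x xs) att))

incHead-attainable⁻ : ∀ {m} μ → IsPartition (2 * m) μ → Attainable (incHead μ) → Attainable μ
incHead-attainable⁻     []       _              att = att
incHead-attainable⁻ {m} (x ∷ xs) (_ , _ , sum≡) att =
  Equivalence.from (attainable-∷⇔ x xs)
    (ℕ.≤-pred (odd-attainable⇒tailWeight<head {m} {suc x} {xs} (cong suc sum≡) att))

lowerHead : ∀ {n x xs} → 0 < n → tailWeight 0 xs < x → IsPartition (suc n) (x ∷ xs) →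
            ∃[ μ ] (IsPartition n μ × x ∷ xs ≡ incHead μ)
lowerHead {x = suc x} {xs} 0<n (s≤s w≤x) partition =
  x ∷ xs , lowerHead-isPartition 0<n (ℕ.≤-trans (sum≤tailWeight 0 xs) w≤x) partition , refl

1≤m⇒0<2*m : ∀ {m} → 1 ≤ m → 0 < 2 * m
1≤m⇒0<2*m {m} 1≤m = ℕ.≤-trans 1≤m (ℕ.m≤n*m m 2)

odd-attainable⇒incHead : ∀ {m} → 1 ≤ m → ∀ l → IsPartition (suc (2 * m)) l → Attainable l →
                         ∃[ μ ] (IsPartition (2 * m) μ × l ≡ incHead μ)
odd-attainable⇒incHead     _   []       (_ , _ , ())
odd-attainable⇒incHead {m} 1≤m (x ∷ xs) partition@(_ , _ , sum≡) att =
  lowerHead (1≤m⇒0<2*m 1≤m)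
            (odd-attainable⇒tailWeight<head {m} {x} {xs} sum≡ att) partition

length≤sum : ∀ l → All (0 <_) l → length l ≤ sum l
length≤sum []      _           = z≤n
length≤sum (x ∷ l) (0<x ∷ 0<l) = ℕ.+-mono-≤ 0<x (length≤sum l 0<l)

all≤sum : ∀ l → All (_≤ sum l) l
all≤sum []      = []
all≤sum (x ∷ l) = ℕ.m≤m+n x (sum l) ∷ All.map (λ y≤s → ℕ.≤-trans y≤s (ℕ.m≤n+m (sum l) x)) (all≤sum l)

∈-listsOf : ∀ n l → All (0 <_) l → All (_≤ n) l → l ∈ listsOf n (length l)
∈-listsOf n []          _         _           = here refl
∈-listsOf n (suc x ∷ l) (_ ∷ 0<l) (x<n ∷ l≤n) =
  ∈-concat⁺′ (∈-map⁺ (suc x ∷_) (∈-listsOf n l 0<l l≤n))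
             (∈-map⁺ (λ y → map (y ∷_) (listsOf n (length l))) (∈-applyUpTo⁺ suc x<n))

partition∈candidates : ∀ {n l} → IsPartition n l → l ∈ candidates n
partition∈candidates {n} {l} (_ , positive , refl) =
  ∈-concat⁺′ (∈-listsOf n l positive (all≤sum l))
             (∈-map⁺ (listsOf n) (∈-applyUpTo⁺ (λ k → k) (s≤s (length≤sum l positive))))

listsOf-length : ∀ n k {l} → l ∈ listsOf n k → length l ≡ k
listsOf-length n zero    (here refl) = refl
listsOf-length n (suc k) l∈
  with vs , l∈vs , vs∈ ← ∈-concat⁻′ (map (λ x → map (x ∷_) (listsOf n k)) (applyUpTo suc n)) l∈
  with x , _ , refl ← ∈-map⁻ (λ x → map (x ∷_) (listsOf n k)) vs∈
  with l′ , l′∈ , refl ← ∈-map⁻ (x ∷_) l∈vs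
  = cong suc (listsOf-length n k l′∈)

concatMap-unique : ∀ {A B : Set} (f : A → List B) {xs} → Unique xs → (∀ x → Unique (f x)) →
                   (∀ {x y} → x ≢ y → Disjoint (f x) (f y)) → Unique (concatMap f xs)
concatMap-unique f unique f-unique f-disjoint =
  Unique.concat⁺ (All.map⁺ (All.universal f-unique _)) (AllPairs.map⁺ (AllPairs.map f-disjoint unique))

listsOf-unique : ∀ n k → Unique (listsOf n k)
listsOf-unique n zero    = [] AllPairs.∷ AllPairs.[]
listsOf-unique n (suc k) = concatMap-unique (λ x → map (x ∷_) (listsOf n k))
  (Unique.applyUpTo⁺₁ suc n (λ i<j _ → ℕ.<⇒≢ i<j ∘′ ℕ.suc-injective))
  (λ x → Unique.map⁺ ∷-injectiveʳ (listsOf-unique n k))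
  disjoint
  where
  disjoint : ∀ {x y} → x ≢ y → Disjoint (map (x ∷_) (listsOf n k)) (map (y ∷_) (listsOf n k))
  disjoint x≢y (∈x , ∈y) with _ , _ , refl ← ∈-map⁻ _ ∈x | _ , _ , eq ← ∈-map⁻ _ ∈y =
    x≢y (∷-injectiveˡ eq)

candidates-unique : ∀ n → Unique (candidates n)
candidates-unique n = concatMap-unique (listsOf n) (Unique.upTo⁺ (suc n)) (listsOf-unique n)
  (λ {k} {k′} k≢k′ (∈k , ∈k′) → k≢k′ (trans (sym (listsOf-length n k ∈k)) (listsOf-length n k′ ∈k′)))

incHead-injective : ∀ {μ ν} → incHead μ ≡ incHead ν → μ ≡ ν
incHead-injective {[]}    {[]}    _    = refl
incHead-injective {_ ∷ _} {_ ∷ _} refl = refl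

attainablePartitions : ℕ → List (List ℕ)
attainablePartitions n = filter (λ l → isPartition? n l ×-dec attainable? l) (candidates n)

∈-attainablePartitions⇔ : ∀ {n l} → l ∈ attainablePartitions n ⇔ (IsPartition n l × Attainable l)
∈-attainablePartitions⇔ {n} = mk⇔
  (λ l∈ → proj₂ (∈-filter⁻ (λ l → isPartition? n l ×-dec attainable? l) {xs = candidates n} l∈))
  (λ p → ∈-filter⁺ (λ l → isPartition? n l ×-dec attainable? l) (partition∈candidates (proj₁ p)) p)

attainablePartitions-unique : ∀ n → Unique (attainablePartitions n)
attainablePartitions-unique n =
  Unique.filter⁺ (λ l → isPartition? n l ×-dec attainable? l) (candidates-unique n)

length-≡-injective-image : ∀ {A B : Set} {f : A → B} {xs ys} → (∀ {x y} → f x ≡ f y → x ≡ y) →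
                           Unique xs → Unique ys → (∀ {y} → y ∈ ys ⇔ y ∈ map f xs) →
                           length ys ≡ length xs
length-≡-injective-image {f = f} {xs} injective xs-unique ys-unique ys≈f[xs] =
  trans (↭-length (∼bag⇒↭ (unique∧set⇒bag ys-unique (Unique.map⁺ injective xs-unique) ys≈f[xs])))
        (length-map f xs)

a-odd≡a-even : ∀ {m} → 1 ≤ m → a (suc (2 * m)) ≡ a (2 * m)
a-odd≡a-even {m} 1≤m = length-≡-injective-image incHead-injective
  (attainablePartitions-unique (2 * m)) (attainablePartitions-unique (suc (2 * m))) (mk⇔ lower raise)
  where
  open Equivalence
  lower : ∀ {l} → l ∈ attainablePartitions (suc (2 * m)) → l ∈ map incHead (attainablePartitions (2 * m))
  lower {l} l∈
    with partition , att ← to ∈-attainablePartitions⇔ l∈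
    with μ , μ-partition , refl ← odd-attainable⇒incHead 1≤m l partition att
    = ∈-map⁺ incHead (from ∈-attainablePartitions⇔ (μ-partition , incHead-attainable⁻ {m} μ μ-partition att))
  raise : ∀ {l} → l ∈ map incHead (attainablePartitions (2 * m)) → l ∈ attainablePartitions (suc (2 * m))
  raise l∈
    with μ , μ∈ , refl ← ∈-map⁻ incHead l∈
    with partition , att ← to ∈-attainablePartitions⇔ μ∈
    = from ∈-attainablePartitions⇔ (incHead-isPartition (1≤m⇒0<2*m 1≤m) partition , incHead-attainable μ att)

lemma3p7 : (m : ℕ) → 1 ≤ m →
    (a (suc (2 * m)) ≡ a (2 * m)) ×
    ((l : List ℕ) → IsPartition (suc (2 * m)) l → Attainable l →
    ∃[ μ ] (IsPartition (2 * m) μ × l ≡ incHead μ))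
lemma3p7 m 1≤m = a-odd≡a-even 1≤m , odd-attainable⇒incHead 1≤m
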